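{- Let $G$ be a graph and let $t\geq 3$, $q\geq 1$ be integers. Then $\mathrm{pthin}(G\bullet tK_1)=\mathrm{indpthin}(G)$, and $\mathrm{pthin}((G\bullet tK_1)\vee qK_1)=\mathrm{pthin}((G\bullet tK_1)\vee K_q)=\mathrm{indpthin}(G)+1$.
   Context: Graphs are finite, simple, undirected. $tK_1$ is the edgeless graph on $t$ vertices and $K_q$ the complete graph on $q$ vertices. The lexicographical product $G_1\bullet G_2$ has vertex set $V_1\times V_2$, and $(u_1,u_2)$, $(v_1,v_2)$ are adjacent iff either $u_1=v_1$ and $u_2v_2\in E_2$, or $u_1v_1\in E_1$. The join $H_1\vee H_2$ of graphs with disjoint vertex sets is their disjoint union plus all edges between the two vertex sets. For a graph $G=(V,E)$, an ordering $v_1,\dots,v_n$ of $V$ and a partition of $V$ are strongly consistent if for every $r<s<t$, whenever $v_r,v_s$ are in the same class and $v_tv_r\in E$ then $v_tv_s\in E$, and whenever $v_s,v_t$ are in the same class and $v_tv_r\in E$ then $v_sv_r\in E$. $\mathrm{pthin}(G)$ is the minimum number of classes of a partition of $V$ strongly consistent with some ordering of $V$; $\mathrm{indpthin}(G)$ is the same minimum when each class is additionally required to be an independent set. -}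

module Defs where

open import Data.Nat using (ℕ; _*_; _+_; _≤_)
open import Data.Fin using (Fin; _<_)
open import Data.Fin.Properties using (*↔×; +↔⊎)
open import Data.Product using (_×_; _,_; ∃; Σ)
open import Data.Sum using (_⊎_; inj₁; inj₂)
open import Data.Empty using (⊥)
open import Data.Unit using (⊤)
open import Relation.Nullary using (¬_)
open import Relation.Binary.PropositionalEquality using (_≡_; _≢_)
open import Function.Bundles using (_↔_; Inverse)
open import Function.Properties.Inverse using (↔-trans)
open import Data.Product.Function.NonDependent.Propositional using (_×-↔_)
open import Data.Sum.Function.Propositional using (_⊎-↔_)

record Graph : Set₁ where
  field
    V      : Set
    size   : ℕ
    enum   : Fin size ↔ V
    E      : V → V → Set
    E-sym  : ∀ {u v} → E u v → E v u
    E-irr  : ∀ {v} → ¬ E v v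
open Graph public

edgeless : ℕ → Graph
edgeless t = record
  { V = Fin t ; size = t ; enum = Inverse-id ; E = λ _ _ → ⊥
  ; E-sym = λ () ; E-irr = λ () }
  where
  open import Function.Construct.Identity using () renaming (↔-id to ↔id)
  Inverse-id : Fin t ↔ Fin t
  Inverse-id = ↔id (Fin t)

complete : ℕ → Graph
complete q = record
  { V = Fin q ; size = q ; enum = ↔id (Fin q) ; E = λ i j → i ≢ j
  ; E-sym = λ p e → p (Relation.Binary.PropositionalEquality.sym e)
  ; E-irr = λ p → p Relation.Binary.PropositionalEquality.refl }
  where
  open import Function.Construct.Identity using () renaming (↔-id to ↔id)

LexE : (G₁ G₂ : Graph) → V G₁ × V G₂ → V G₁ × V G₂ → Set
LexE G₁ G₂ (u₁ , u₂) (v₁ , v₂) = (u₁ ≡ v₁ × E G₂ u₂ v₂) ⊎ E G₁ u₁ v₁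

_•_ : Graph → Graph → Graph
G₁ • G₂ = record
  { V = V G₁ × V G₂
  ; size = size G₁ * size G₂
  ; enum = ↔-trans *↔× (enum G₁ ×-↔ enum G₂)
  ; E = LexE G₁ G₂
  ; E-sym = λ {u} {v} → sy {u} {v}
  ; E-irr = λ {v} → ir {v} }
  where
  open import Relation.Binary.PropositionalEquality using (sym; refl)
  sy : ∀ {u v} → LexE G₁ G₂ u v → LexE G₁ G₂ v u
  sy (inj₁ (e , a)) = inj₁ (sym e , E-sym G₂ a)
  sy (inj₂ a) = inj₂ (E-sym G₁ a)
  ir : ∀ {v} → ¬ LexE G₁ G₂ v v
  ir (inj₁ (_ , a)) = E-irr G₂ a
  ir (inj₂ a) = E-irr G₁ a

JoinE : (H₁ H₂ : Graph) → V H₁ ⊎ V H₂ → V H₁ ⊎ V H₂ → Set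
JoinE H₁ H₂ (inj₁ a) (inj₁ b) = E H₁ a b
JoinE H₁ H₂ (inj₂ a) (inj₂ b) = E H₂ a b
JoinE H₁ H₂ (inj₁ _) (inj₂ _) = ⊤
JoinE H₁ H₂ (inj₂ _) (inj₁ _) = ⊤

_∨_ : Graph → Graph → Graph
H₁ ∨ H₂ = record
  { V = V H₁ ⊎ V H₂
  ; size = size H₁ + size H₂
  ; enum = ↔-trans +↔⊎ (enum H₁ ⊎-↔ enum H₂)
  ; E = JoinE H₁ H₂
  ; E-sym = λ {u} {v} → sy {u} {v}
  ; E-irr = λ {v} → ir {v} }
  where
  sy : ∀ {u v} → JoinE H₁ H₂ u v → JoinE H₁ H₂ v u
  sy {inj₁ _} {inj₁ _} a = E-sym H₁ a
  sy {inj₂ _} {inj₂ _} a = E-sym H₂ a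
  sy {inj₁ _} {inj₂ _} a = _
  sy {inj₂ _} {inj₁ _} a = _
  ir : ∀ {v} → ¬ JoinE H₁ H₂ v v
  ir {inj₁ _} a = E-irr H₁ a
  ir {inj₂ _} a = E-irr H₂ a

Ordering : Graph → Set
Ordering G = Fin (size G) ↔ V G

-- A partition of V(G) into exactly k (nonempty) classes: a surjective
-- class-assignment V G → Fin k.
record Partition (G : Graph) (k : ℕ) : Set where
  field
    cls  : V G → Fin k
    surj : ∀ (i : Fin k) → ∃ λ v → cls v ≡ i
open Partition public

StronglyConsistent : (G : Graph) {k : ℕ} → Ordering G → Partition G k → Set
StronglyConsistent G σ P =
  ∀ (r s t : Fin (size G)) → r < s → s < t →
    (cls P (v r) ≡ cls P (v s) → E G (v t) (v r) → E G (v t) (v s)) ×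
    (cls P (v s) ≡ cls P (v t) → E G (v t) (v r) → E G (v s) (v r))
  where v = Inverse.to σ

Independent : (G : Graph) {k : ℕ} → Partition G k → Set
Independent G P = ∀ u v → cls P u ≡ cls P v → ¬ E G u v

HasPthin : Graph → ℕ → Set
HasPthin G k = Σ (Ordering G) λ σ → Σ (Partition G k) λ P → StronglyConsistent G σ P

HasIndPthin : Graph → ℕ → Set
HasIndPthin G k = Σ (Ordering G) λ σ → Σ (Partition G k) λ P →
  StronglyConsistent G σ P × Independent G P

PthinIs : Graph → ℕ → Set
PthinIs G k = HasPthin G k × (∀ j → HasPthin G j → k ≤ j)

IndPthinIs : Graph → ℕ → Set
IndPthinIs G k = HasIndPthin G k × (∀ j → HasIndPthin G j → k ≤ j)

module Submission where

-- Strong consistency is first rephrased on vertices: an ordering is read as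
-- a key V → ℕ (the position), and conversely every injective key gives an
-- ordering by ranking, so orderings may be built from keys.
--
-- An independent consistent pair (σ , P) of G lifts to
-- G • tK₁ by ordering lexicographically (σ first, then the twin index) with
-- the classes of P; independence of the classes is exactly what is needed
-- for twins.  Joining a graph X with a one-class consistent ordering (qK₁ or
-- K_q) costs one extra class, placing X last.
--
-- Given a consistent pair (σ , P) of a graph K containing an
-- induced copy of G • tK₁, each vertex u of G has three twins; the middle one
-- m u (in σ) has a twin before and a twin after it.  Since twins are never
-- adjacent, consistency forces the classes of the middle copies to be
-- independent, and ordering G by the positions of the m u gives an
-- independent consistent pair of G with at most as many classes.  If K has a
-- vertex adjacent to the whole copy (the other side of a join), its class
-- contains no middle copy, which saves one class.

open import Defs
open import Data.Nat using (ℕ; suc; _≤_)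
open import Data.Product using (_×_)
open import Function.Bundles using (_⇔_)

open import Data.Nat using (zero; _+_; _<_; _<?_; z≤n; s≤s)
open import Data.Nat.Properties
  using (≤-refl; ≤-trans; ≤-antisym; <-trans; <-irrefl; <-asym; <-cmp; <-≤-trans;
         m≤n⇒m≤1+n; m≤m+n; +-cancelˡ-≡; +-cancelˡ-<; +-cancelˡ-≤; +-monoʳ-≤)
open import Data.Fin as Fin using (Fin; toℕ; fromℕ<; punchOut; combine)
open import Data.Fin.Properties
  using (toℕ-fromℕ<; toℕ-injective; toℕ<n; punchOut-injective; injective⇒≤;
         combine-injective; combine-monoˡ-<; any?; all?; ¬∀⟶∃¬; <⇒≢; suc-injective)
  renaming (_≟_ to _≟ᶠ_; <-cmp to <-cmpᶠ)
open import Data.Product using (_,_; ∃; Σ; proj₁; proj₂)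
open import Data.Sum using (_⊎_; inj₁; inj₂)
open import Data.Empty using (⊥-elim)
open import Data.Unit using (⊤; tt)
open import Relation.Nullary using (¬_; yes; no; contradiction)
open import Relation.Unary using (Decidable)
open import Relation.Binary using (tri<; tri≈; tri>)
open import Relation.Binary.PropositionalEquality
  using (_≡_; _≢_; refl; sym; cong; subst)
open import Function using (_∘_)
open import Function.Bundles using (_↔_; Inverse; Injection; mk↔ₛ′; mk⇔)
open import Function.Properties.Inverse using (↔-trans; ↔-sym; ↔⇒↣)
open import Function.Construct.Identity using (↔-id)

ConsistentAlong : (K : Graph) (_≺_ : V K → V K → Set) {C : Set} (c : V K → C) → Set
ConsistentAlong K _≺_ c = ∀ x y z → x ≺ y → y ≺ z →
  (c x ≡ c y → E K z x → E K z y) × (c y ≡ c z → E K z x → E K y x)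

KeyOrder : {A : Set} → (A → ℕ) → A → A → Set
KeyOrder κ x y = κ x < κ y

position : (K : Graph) → Ordering K → V K → ℕ
position K σ x = toℕ (Inverse.from σ x)

position-injective : (K : Graph) (σ : Ordering K) {x y : V K} →
  position K σ x ≡ position K σ y → x ≡ y
position-injective K σ = Injection.injective (↔⇒↣ (↔-sym σ)) ∘ toℕ-injective

consistentAlongPositions : (K : Graph) (σ : Ordering K) {k : ℕ} (P : Partition K k) →
  StronglyConsistent K σ P → ConsistentAlong K (KeyOrder (position K σ)) (cls P)
consistentAlongPositions K σ P sc x y z
  with Inverse.from σ x | Inverse.strictlyInverseˡ σ x
     | Inverse.from σ y | Inverse.strictlyInverseˡ σ y
     | Inverse.from σ z | Inverse.strictlyInverseˡ σ z
... | r | refl | s | refl | t | refl = sc r s t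

count : ∀ {n} {P : Fin n → Set} → Decidable P → ℕ
count {zero}  P? = 0
count {suc n} P? with P? Fin.zero
... | yes _ = suc (count (P? ∘ Fin.suc))
... | no  _ = count (P? ∘ Fin.suc)

count-mono : ∀ {n} {P Q : Fin n → Set} (P? : Decidable P) (Q? : Decidable Q) →
  (∀ i → P i → Q i) → count P? ≤ count Q?
count-mono {zero}  P? Q? P⊆Q = z≤n
count-mono {suc n} P? Q? P⊆Q with P? Fin.zero | Q? Fin.zero
... | yes _ | yes _ = s≤s (count-mono _ _ (P⊆Q ∘ Fin.suc))
... | yes p | no ¬q = contradiction (P⊆Q Fin.zero p) ¬q
... | no _  | yes _ = m≤n⇒m≤1+n (count-mono _ _ (P⊆Q ∘ Fin.suc))
... | no _  | no _  = count-mono _ _ (P⊆Q ∘ Fin.suc)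

count-strict : ∀ {n} {P Q : Fin n → Set} (P? : Decidable P) (Q? : Decidable Q) →
  (∀ i → P i → Q i) → ∀ j → Q j → ¬ P j → count P? < count Q?
count-strict {suc n} P? Q? P⊆Q Fin.zero qj ¬pj with P? Fin.zero | Q? Fin.zero
... | yes p | _     = contradiction p ¬pj
... | no _  | yes _ = s≤s (count-mono _ _ (P⊆Q ∘ Fin.suc))
... | no _  | no ¬q = contradiction qj ¬q
count-strict {suc n} P? Q? P⊆Q (Fin.suc j) qj ¬pj with P? Fin.zero | Q? Fin.zero
... | yes _ | yes _ = s≤s (count-strict _ _ (P⊆Q ∘ Fin.suc) j qj ¬pj)
... | yes p | no ¬q = contradiction (P⊆Q Fin.zero p) ¬q
... | no _  | yes _ = m≤n⇒m≤1+n (count-strict _ _ (P⊆Q ∘ Fin.suc) j qj ¬pj)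
... | no _  | no _  = count-strict _ _ (P⊆Q ∘ Fin.suc) j qj ¬pj

count-all : ∀ {n} → count {n} {λ _ → ⊤} (λ _ → yes tt) ≡ n
count-all {zero}  = refl
count-all {suc n} = cong suc count-all

injective⇒surjective : ∀ {m} (f : Fin m → Fin m) →
  (∀ i j → f i ≡ f j → i ≡ j) → ∀ y → ∃ λ i → f i ≡ y
injective⇒surjective {suc m} f f-injective y with any? (λ i → f i ≟ᶠ y)
... | yes hit = hit
... | no miss = contradiction (injective⇒≤ squeezed-injective) (<-irrefl refl)
  where
  -- missing y, f squeezes into Fin m
  avoids : ∀ i → y ≢ f i
  avoids i y≡fi = miss (i , sym y≡fi)
  squeezed-injective : ∀ {i j} → punchOut (avoids i) ≡ punchOut (avoids j) → i ≡ j
  squeezed-injective {i} {j} = f-injective i j ∘ punchOut-injective (avoids i) (avoids j)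

-- Sorting Fin n by an injective key f: position r holds the element of rank r,
-- the rank of i being the number of elements with a smaller key.
module Ranking {n : ℕ} (f : Fin n → ℕ) (f-injective : ∀ i j → f i ≡ f j → i ≡ j) where

  private
    rankℕ : Fin n → ℕ
    rankℕ i = count (λ j → f j <? f i)

    rankℕ<n : ∀ i → rankℕ i < n
    rankℕ<n i = subst (rankℕ i <_) count-all
      (count-strict _ (λ _ → yes tt) (λ _ _ → tt) i tt (<-irrefl refl))

    rank : Fin n → Fin n
    rank i = fromℕ< (rankℕ<n i)

    rank-increasing : ∀ i j → f i < f j → rank i Fin.< rank j
    rank-increasing i j fi<fj
      rewrite toℕ-fromℕ< (rankℕ<n i) | toℕ-fromℕ< (rankℕ<n j) =
      count-strict _ _ (λ _ fk<fi → <-trans fk<fi fi<fj) i fi<fj (<-irrefl refl)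

    rank-injective : ∀ i j → rank i ≡ rank j → i ≡ j
    rank-injective i j same with <-cmp (f i) (f j)
    ... | tri< fi<fj _ _ = contradiction same (<⇒≢ (rank-increasing i j fi<fj))
    ... | tri≈ _ fi≡fj _ = f-injective i j fi≡fj
    ... | tri> _ _ fj<fi = contradiction (sym same) (<⇒≢ (rank-increasing j i fj<fi))

    rank-surjective : ∀ r → ∃ λ i → rank i ≡ r
    rank-surjective = injective⇒surjective rank rank-injective

  sorted : Fin n ↔ Fin n
  sorted = mk↔ₛ′ (proj₁ ∘ rank-surjective) rank
    (λ i → rank-injective _ _ (proj₂ (rank-surjective (rank i))))
    (proj₂ ∘ rank-surjective)

  sorted-increasing : ∀ {r s} → r Fin.< s → f (Inverse.to sorted r) < f (Inverse.to sorted s)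
  sorted-increasing {r} {s} r<s with rank-surjective r | rank-surjective s
  ... | i , refl | j , refl with <-cmp (f i) (f j)
  ... | tri< fi<fj _ _ = fi<fj
  ... | tri≈ _ fi≡fj _ = contradiction (cong rank (f-injective i j fi≡fj)) (<⇒≢ r<s)
  ... | tri> _ _ fj<fi = contradiction r<s (<-asym (rank-increasing j i fj<fi))

module KeyOrdering (K : Graph) (κ : V K → ℕ) (κ-injective : ∀ x y → κ x ≡ κ y → x ≡ y) where

  private
    keyAt : Fin (size K) → ℕ
    keyAt = κ ∘ Inverse.to (enum K)

    keyAt-injective : ∀ i j → keyAt i ≡ keyAt j → i ≡ j
    keyAt-injective i j = Injection.injective (↔⇒↣ (enum K)) ∘ κ-injective _ _

    open Ranking keyAt keyAt-injective

  keyOrdering : Ordering K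
  keyOrdering = ↔-trans sorted (enum K)

  keyOrdering-consistent : ∀ {k} (Q : Partition K k) →
    ConsistentAlong K (KeyOrder κ) (cls Q) → StronglyConsistent K keyOrdering Q
  keyOrdering-consistent Q consistent r s t r<s s<t =
    consistent _ _ _ (sorted-increasing r<s) (sorted-increasing s<t)

Finer : {A B C : Set} → (A → B) → (A → C) → Set
Finer g f = ∀ a b → g a ≡ g b → f a ≡ f b

Finer-trans : {A B C D : Set} {h : A → B} {g : A → C} {f : A → D} →
  Finer h g → Finer g f → Finer h f
Finer-trans h⊑g g⊑f a b = g⊑f a b ∘ h⊑g a b

renumberWithout : {A : Set} {j : ℕ} (c : Fin (suc j)) (f : A → Fin (suc j)) →
  (∀ a → c ≢ f a) → Σ (A → Fin j) λ g → Finer g f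
renumberWithout c f misses =
  (λ a → punchOut (misses a)) , λ a b → punchOut-injective (misses a) (misses b)

attained? : (G : Graph) {j : ℕ} (f : V G → Fin j) →
  Decidable (λ c → ∃ λ i → f (Inverse.to (enum G) i) ≡ c)
attained? G f c = any? (λ i → f (Inverse.to (enum G) i) ≟ᶠ c)

coarsen : (G : Graph) {j : ℕ} (f : V G → Fin j) →
  Σ ℕ λ j' → j' ≤ j × Σ (Partition G j') λ Q → Finer (cls Q) f
coarsen G {zero} f = 0 , z≤n , record { cls = f ; surj = λ () } , λ _ _ same → same
coarsen G {suc j} f with all? (attained? G f)
... | yes onto = suc j , ≤-refl , Q , λ _ _ same → same
  where
  Q : Partition G (suc j)
  Q = record { cls = f ; surj = λ c → Inverse.to (enum G) (proj₁ (onto c)) , proj₂ (onto c) }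
... | no ¬onto =
  let c , unattained = ¬∀⟶∃¬ _ _ (attained? G f) ¬onto
      misses : ∀ a → c ≢ f a
      misses a c≡fa = unattained (Inverse.from (enum G) a ,
        subst (λ v → f v ≡ c) (sym (Inverse.strictlyInverseˡ (enum G) a)) (sym c≡fa))
      g , g⊑f = renumberWithout c f misses
      j' , j'≤j , Q , Q⊑g = coarsen G g
  in j' , m≤n⇒m≤1+n j'≤j , Q , Finer-trans Q⊑g g⊑f

coarsenAvoiding : (G : Graph) {j : ℕ} (c : Fin j) (f : V G → Fin j) → (∀ a → c ≢ f a) →
  Σ ℕ λ j' → suc j' ≤ j × Σ (Partition G j') λ Q → Finer (cls Q) f
coarsenAvoiding G {suc j} c f misses =
  let g , g⊑f = renumberWithout c f misses
      j' , j'≤j , Q , Q⊑g = coarsen G g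
  in j' , s≤s j'≤j , Q , Finer-trans Q⊑g g⊑f

record Between {A : Set} (κ : A → ℕ) : Set where
  constructor between
  field
    below middle above : A
    below<middle : κ below < κ middle
    middle<above : κ middle < κ above

median : {A : Set} (κ : A → ℕ) (x y z : A) →
  κ x ≢ κ y → κ x ≢ κ z → κ y ≢ κ z → Between κ
median κ x y z x≢y x≢z y≢z with <-cmp (κ x) (κ y) | <-cmp (κ y) (κ z) | <-cmp (κ x) (κ z)
... | tri≈ _ x≡y _ | _ | _ = contradiction x≡y x≢y
... | _ | tri≈ _ y≡z _ | _ = contradiction y≡z y≢z
... | _ | _ | tri≈ _ x≡z _ = contradiction x≡z x≢z
... | tri< x<y _ _ | tri< y<z _ _ | _            = between x y z x<y y<z
... | tri< x<y _ _ | tri> _ _ z<y | tri< x<z _ _ = between x z y x<z z<y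
... | tri< x<y _ _ | tri> _ _ z<y | tri> _ _ z<x = between z x y z<x x<y
... | tri> _ _ y<x | tri> _ _ z<y | _            = between z y x z<y y<x
... | tri> _ _ y<x | tri< y<z _ _ | tri< x<z _ _ = between y x z y<x x<z
... | tri> _ _ y<x | tri< y<z _ _ | tri> _ _ z<x = between y z x y<z z<x

lexEdgeless-edge : (G : Graph) {t : ℕ} {u w : V G} (a b : Fin t) →
  E (G • edgeless t) (u , a) (w , b) → E G u w
lexEdgeless-edge G a b (inj₁ (_ , ()))
lexEdgeless-edge G a b (inj₂ uw) = uw

record InducedCopy (H K : Graph) : Set where
  field
    embed     : V H → V K
    injective : ∀ x y → embed x ≡ embed y → x ≡ y
    preserves : ∀ {x y} → E H x y → E K (embed x) (embed y)
    reflects  : ∀ {x y} → E K (embed x) (embed y) → E H x y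

identityCopy : (H : Graph) → InducedCopy H H
identityCopy H = record
  { embed = λ x → x ; injective = λ _ _ e → e ; preserves = λ e → e ; reflects = λ e → e }

joinˡCopy : (H X : Graph) → InducedCopy H (H ∨ X)
joinˡCopy H X = record
  { embed = inj₁ ; injective = λ { _ _ refl → refl } ; preserves = λ e → e ; reflects = λ e → e }

module LowerBound (G : Graph) (t' : ℕ) {K : Graph}
  (copy : InducedCopy (G • edgeless (suc (suc (suc t')))) K)
  (σ : Ordering K) {j : ℕ} (P : Partition K j) (sc : StronglyConsistent K σ P) where

  open InducedCopy copy

  pos : V K → ℕ
  pos = position K σ

  consistent : ConsistentAlong K (KeyOrder pos) (cls P)
  consistent = consistentAlongPositions K σ P sc

  copyOf : V G → Fin (suc (suc (suc t'))) → V K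
  copyOf u a = embed (u , a)

  copies-adjacent : ∀ {u w} a b → E G u w → E K (copyOf u a) (copyOf w b)
  copies-adjacent a b uw = preserves (inj₂ uw)

  adjacent-copies : ∀ {u w a b} → E K (copyOf u a) (copyOf w b) → E G u w
  adjacent-copies {a = a} {b} = lexEdgeless-edge G a b ∘ reflects

  twins-nonadjacent : ∀ u a b → ¬ E K (copyOf u a) (copyOf u b)
  twins-nonadjacent u a b = E-irr G ∘ adjacent-copies

  twinsAround : ∀ u → Between (λ a → pos (copyOf u a))
  twinsAround u = median _ Fin.zero (Fin.suc Fin.zero) (Fin.suc (Fin.suc Fin.zero))
    (distinct λ ()) (distinct λ ()) (distinct λ ())
    where
    distinct : ∀ {a b} → a ≢ b → pos (copyOf u a) ≢ pos (copyOf u b)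
    distinct a≢b = a≢b ∘ cong proj₂ ∘ injective _ _ ∘ position-injective K σ

  open Between using (below<middle; middle<above)

  m earlierTwin laterTwin : V G → V K
  m u          = copyOf u (Between.middle (twinsAround u))
  earlierTwin u = copyOf u (Between.below (twinsAround u))
  laterTwin u   = copyOf u (Between.above (twinsAround u))

  m-injective : ∀ a b → m a ≡ m b → a ≡ b
  m-injective a b = cong proj₁ ∘ injective _ _

  -- Middle copies of adjacent vertices are never in one class: the twin of b
  -- after m b would be forced adjacent to m b.
  middle-independent-ordered : ∀ a b → pos (m a) < pos (m b) →
    cls P (m a) ≡ cls P (m b) → ¬ E G a b
  middle-independent-ordered a b ma<mb same ab = twins-nonadjacent b _ _
    (proj₁ (consistent (m a) (m b) (laterTwin b) ma<mb (middle<above (twinsAround b)))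
      same (copies-adjacent _ _ (E-sym G ab)))

  middle-independent : ∀ a b → cls P (m a) ≡ cls P (m b) → ¬ E G a b
  middle-independent a b same ab with <-cmp (pos (m a)) (pos (m b))
  ... | tri< ma<mb _ _ = middle-independent-ordered a b ma<mb same ab
  ... | tri≈ _ e _     = E-irr G (subst (E G a) (sym (m-injective a b (position-injective K σ e))) ab)
  ... | tri> _ _ mb<ma = middle-independent-ordered b a mb<ma (sym same) (E-sym G ab)

  universal-class-unused : (z : V K) → (∀ p → E K z (embed p)) → ∀ a → cls P z ≢ cls P (m a)
  universal-class-unused z adj a same with <-cmp (pos (m a)) (pos z)
  ... | tri< ma<z _ _ = twins-nonadjacent a _ _
    (proj₂ (consistent (earlierTwin a) (m a) z (below<middle (twinsAround a)) ma<z) (sym same) (adj _))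
  ... | tri≈ _ e _    = E-irr K (subst (E K z) (position-injective K σ e) (adj _))
  ... | tri> _ _ z<ma = twins-nonadjacent a _ _
    (proj₁ (consistent z (m a) (laterTwin a) z<ma (middle<above (twinsAround a))) same (E-sym K (adj _)))

  restrict : ∀ {k} (Q : Partition G k) → Finer (cls Q) (cls P ∘ m) → HasIndPthin G k
  restrict Q Q⊑P = keyOrdering , Q , keyOrdering-consistent Q inherited ,
    λ a b same → middle-independent a b (Q⊑P a b same)
    where
    open KeyOrdering G (pos ∘ m) (λ a b → m-injective a b ∘ position-injective K σ)
    inherited : ConsistentAlong G (KeyOrder (pos ∘ m)) (cls Q)
    inherited x y z x<y y<z =
      (λ same zx → adjacent-copies (proj₁ middles (Q⊑P x y same) (copies-adjacent _ _ zx))) ,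
      (λ same zx → adjacent-copies (proj₂ middles (Q⊑P y z same) (copies-adjacent _ _ zx)))
      where
      middles : (cls P (m x) ≡ cls P (m y) → E K (m z) (m x) → E K (m z) (m y)) ×
                (cls P (m y) ≡ cls P (m z) → E K (m z) (m x) → E K (m y) (m x))
      middles = consistent (m x) (m y) (m z) x<y y<z

  lower : Σ ℕ λ j' → j' ≤ j × HasIndPthin G j'
  lower with coarsen G (cls P ∘ m)
  ... | j' , j'≤j , Q , Q⊑P = j' , j'≤j , restrict Q Q⊑P

  lowerWithUniversal : (z : V K) → (∀ p → E K z (embed p)) →
    Σ ℕ λ j' → suc j' ≤ j × HasIndPthin G j'
  lowerWithUniversal z adj with coarsenAvoiding G (cls P z) (cls P ∘ m) (universal-class-unused z adj)
  ... | j' , j'<j , Q , Q⊑P = j' , j'<j , restrict Q Q⊑P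

lexUpper : {G : Graph} {t' k : ℕ} → HasIndPthin G k → HasPthin (G • edgeless (suc t')) k
lexUpper {G} {t'} {k} (σ , P , sc , ind) = keyOrdering , Q , keyOrdering-consistent Q consistent
  where
  H : Graph
  H = G • edgeless (suc t')

  pos : V G → ℕ
  pos = position G σ

  key : V H → ℕ
  key (u , a) = toℕ (combine (Inverse.from σ u) a)

  key-injective : ∀ x y → key x ≡ key y → x ≡ y
  key-injective (u , a) (w , b) e
    with combine-injective (Inverse.from σ u) a (Inverse.from σ w) b (toℕ-injective e)
  ... | u≡w , refl with position-injective G σ (cong toℕ u≡w)
  ... | refl = refl

  open KeyOrdering H key key-injective

  Q : Partition H k
  Q = record { cls = cls P ∘ proj₁ ; surj = λ i → (proj₁ (surj P i) , Fin.zero) , proj₂ (surj P i) }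

  twinOrLater : ∀ {u a w b} → key (u , a) < key (w , b) → u ≡ w ⊎ pos u < pos w
  twinOrLater {u} {a} {w} {b} lt with <-cmpᶠ (Inverse.from σ u) (Inverse.from σ w)
  ... | tri< u<w _ _ = inj₂ u<w
  ... | tri≈ _ u≡w _ = inj₁ (position-injective G σ (cong toℕ u≡w))
  ... | tri> _ _ w<u = contradiction lt (<-asym (combine-monoˡ-< b a w<u))

  consistentG : ConsistentAlong G (KeyOrder pos) (cls P)
  consistentG = consistentAlongPositions G σ P sc

  consistent : ConsistentAlong H (KeyOrder key) (cls Q)
  consistent (ur , ar) (us , _) (ut , at) r<s s<t =
    (λ same e → inj₂ (forward  (twinOrLater r<s) (twinOrLater s<t) same (lexEdgeless-edge G at ar e))) ,
    (λ same e → inj₂ (backward (twinOrLater r<s) (twinOrLater s<t) same (lexEdgeless-edge G at ar e)))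
    where
    -- The two implications on G: twins have the same neighbours, a
    -- same-class pair of twins would be adjacent against independence,
    -- and otherwise the consistency of σ applies.
    forward : ur ≡ us ⊎ pos ur < pos us → us ≡ ut ⊎ pos us < pos ut →
      cls P ur ≡ cls P us → E G ut ur → E G ut us
    forward (inj₁ refl) _ _ tr = tr
    forward (inj₂ _) (inj₁ refl) same tr = ⊥-elim (ind us ur (sym same) tr)
    forward (inj₂ r<s') (inj₂ s<t') same tr = proj₁ (consistentG ur us ut r<s' s<t') same tr
    backward : ur ≡ us ⊎ pos ur < pos us → us ≡ ut ⊎ pos us < pos ut →
      cls P us ≡ cls P ut → E G ut ur → E G us ur
    backward _ (inj₁ refl) _ tr = tr
    backward (inj₁ refl) (inj₂ _) same tr = ⊥-elim (ind ut ur (sym same) tr)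
    backward (inj₂ r<s') (inj₂ s<t') same tr = proj₂ (consistentG ur us ut r<s' s<t') same tr

joinUpper : {H X : Graph} {k : ℕ} → HasPthin H k → HasPthin X 1 → HasPthin (H ∨ X) (suc k)
joinUpper {H} {X} {k} (σ , P , sc) (σX , PX , scX) =
  keyOrdering , P' , keyOrdering-consistent P' consistent
  where
  κ : V (H ∨ X) → ℕ
  κ (inj₁ x) = position H σ x
  κ (inj₂ z) = size H + position X σX z

  H-first : ∀ x z → position H σ x < size H + position X σX z
  H-first x z = <-≤-trans (toℕ<n (Inverse.from σ x)) (m≤m+n (size H) _)

  κ-injective : ∀ x y → κ x ≡ κ y → x ≡ y
  κ-injective (inj₁ x) (inj₁ y) e = cong inj₁ (position-injective H σ e)
  κ-injective (inj₂ x) (inj₂ y) e = cong inj₂ (position-injective X σX (+-cancelˡ-≡ (size H) _ _ e))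
  κ-injective (inj₁ x) (inj₂ y) e = ⊥-elim (<-irrefl e (H-first x y))
  κ-injective (inj₂ x) (inj₁ y) e = ⊥-elim (<-irrefl (sym e) (H-first y x))

  open KeyOrdering (H ∨ X) κ κ-injective

  P' : Partition (H ∨ X) (suc k)
  P' = record { cls = c ; surj = onto }
    where
    c : V (H ∨ X) → Fin (suc k)
    c (inj₁ x) = Fin.suc (cls P x)
    c (inj₂ _) = Fin.zero
    onto : ∀ i → ∃ λ v → c v ≡ i
    onto Fin.zero    = inj₂ (proj₁ (surj PX Fin.zero)) , refl
    onto (Fin.suc i) = inj₁ (proj₁ (surj P i)) , cong Fin.suc (proj₂ (surj P i))

  oneClass : ∀ x y → cls PX x ≡ cls PX y
  oneClass x y with cls PX x | cls PX y
  ... | Fin.zero | Fin.zero = refl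

  consistentH : ConsistentAlong H (KeyOrder (position H σ)) (cls P)
  consistentH = consistentAlongPositions H σ P sc

  consistentX : ConsistentAlong X (KeyOrder (position X σX)) (cls PX)
  consistentX = consistentAlongPositions X σX PX scX

  consistent : ConsistentAlong (H ∨ X) (KeyOrder κ) (cls P')
  consistent (inj₁ x) (inj₁ y) (inj₁ z) x<y y<z =
    (proj₁ (consistentH x y z x<y y<z) ∘ suc-injective) ,
    (proj₂ (consistentH x y z x<y y<z) ∘ suc-injective)
  consistent (inj₁ x) (inj₁ y) (inj₂ z) _ _ = (λ _ _ → tt) , λ ()
  consistent (inj₁ x) (inj₂ y) (inj₂ z) _ _ = (λ ()) , λ _ _ → tt
  consistent (inj₂ x) (inj₂ y) (inj₂ z) x<y y<z =
    (λ _ → proj₁ (consistentX x y z x<y' y<z') (oneClass x y)) ,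
    (λ _ → proj₂ (consistentX x y z x<y' y<z') (oneClass y z))
    where
    x<y' : position X σX x < position X σX y
    x<y' = +-cancelˡ-< (size H) _ _ x<y
    y<z' : position X σX y < position X σX z
    y<z' = +-cancelˡ-< (size H) _ _ y<z
  consistent (inj₂ x) (inj₁ y) _ x<y _ = contradiction x<y (<-asym (H-first y x))
  consistent _ (inj₂ y) (inj₁ z) _ y<z = contradiction y<z (<-asym (H-first z y))

singleClass : (X : Graph) → V X → Partition X 1
singleClass X x = record { cls = λ _ → Fin.zero ; surj = λ { Fin.zero → x , refl } }

edgeless-oneClass : ∀ q → HasPthin (edgeless (suc q)) 1
edgeless-oneClass q = ↔-id _ , singleClass _ Fin.zero , λ _ _ _ _ _ → (λ _ ()) , (λ _ ())

complete-oneClass : ∀ q → HasPthin (complete (suc q)) 1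
complete-oneClass q = ↔-id _ , singleClass _ Fin.zero ,
  λ r s t r<s s<t → (λ _ _ t≡s → <⇒≢ s<t (sym t≡s)) , (λ _ _ s≡r → <⇒≢ r<s (sym s≡r))

minimum-shift : (d : ℕ) (A B : ℕ → Set) →
  (∀ k → B k → A (d + k)) → (∀ j → A j → Σ ℕ λ j' → d + j' ≤ j × B j') →
  ∀ k → (A (d + k) × (∀ j → A j → d + k ≤ j)) ⇔ (B k × (∀ j → B j → k ≤ j))
minimum-shift d A B up down k = mk⇔ toB toA
  where
  toB : A (d + k) × (∀ j → A j → d + k ≤ j) → B k × (∀ j → B j → k ≤ j)
  toB (a , minA) with down (d + k) a
  ... | j' , j'≤k , b = subst B (≤-antisym (+-cancelˡ-≤ d _ _ j'≤k) (minB j' b)) b , minB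
    where
    minB : ∀ j → B j → k ≤ j
    minB j bj = +-cancelˡ-≤ d _ _ (minA _ (up j bj))
  toA : B k × (∀ j → B j → k ≤ j) → A (d + k) × (∀ j → A j → d + k ≤ j)
  toA (b , minB) = up k b , minA
    where
    minA : ∀ j → A j → d + k ≤ j
    minA j a with down j a
    ... | j' , j'≤j , b' = ≤-trans (+-monoʳ-≤ d (minB j' b')) j'≤j

theorem4p21 : (G : Graph) (t q : ℕ) → 3 ≤ t → 1 ≤ q → (k : ℕ) →
    (PthinIs (G • edgeless t) k ⇔ IndPthinIs G k) ×
    (PthinIs ((G • edgeless t) ∨ edgeless q) (suc k) ⇔ IndPthinIs G k) ×
    (PthinIs ((G • edgeless t) ∨ complete q) (suc k) ⇔ IndPthinIs G k)
theorem4p21 G (suc (suc (suc t'))) (suc q') (s≤s (s≤s (s≤s _))) (s≤s z≤n) k =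
  minimum-shift 0 (HasPthin H) (HasIndPthin G) (λ _ → lexUpper) lexLower k ,
  minimum-shift 1 (HasPthin (H ∨ edgeless (suc q'))) (HasIndPthin G)
    (λ _ → joinWith (edgeless-oneClass q')) (joinLower Fin.zero) k ,
  minimum-shift 1 (HasPthin (H ∨ complete (suc q'))) (HasIndPthin G)
    (λ _ → joinWith (complete-oneClass q')) (joinLower Fin.zero) k
  where
  H : Graph
  H = G • edgeless (suc (suc (suc t')))

  lexLower : ∀ j → HasPthin H j → Σ ℕ λ j' → j' ≤ j × HasIndPthin G j'
  lexLower j (σ , P , sc) = LowerBound.lower G t' (identityCopy H) σ P sc

  joinWith : ∀ {X k} → HasPthin X 1 → HasIndPthin G k → HasPthin (H ∨ X) (suc k)
  joinWith oneClassX b = joinUpper (lexUpper b) oneClassX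

  -- a vertex of X is adjacent to all of H, which saves one class
  joinLower : ∀ {X} → V X → ∀ j → HasPthin (H ∨ X) j → Σ ℕ λ j' → suc j' ≤ j × HasIndPthin G j'
  joinLower {X} z j (σ , P , sc) =
    LowerBound.lowerWithUniversal G t' (joinˡCopy H X) σ P sc (inj₂ z) (λ _ → tt)
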